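{- Let $(W,S)$ be a finite Coxeter system and $K\subseteq S$. If $z,w\in W$ satisfy $z\in X_K^{ -1}$ and $\omega_K\circ z\le_B w$ (weak Bruhat order on $W$), then $W_K\circ z\le_B W_J\circ w$ in $P^{(W,S)}$ for every $J\subseteq S$ with $w\in X_J^{ -1}$.
   Context: $(W,S)$ is a finite Coxeter system with product $\circ$ and length $l$. $W_J$ is the standard parabolic subgroup generated by $J\subseteq S$, $X_J=\{w\in W: l(w\circ s)>l(w)\ \forall s\in J\}$, $X_J^{ -1}$ its set of inverses. Weak Bruhat order on $W$: $x\le_B x'$ iff $x'=y\circ x$ with $l(x')=l(y)+l(x)$. With $\omega_S$ the longest element of $W$, for $J\subseteq S$ there are unique $\xi_J\in X_J$, $\omega_J\in W_J$ with $\omega_S=\xi_J\circ\omega_J$. For $s\in S\setminus J$, $\alpha_{J,s}\in X_J\cap W_{J\cup\{s\}}$ is defined by $\xi_J=\xi_{J\cup\{s\}}\circ\alpha_{J,s}$. $P^{(W,S)}=\{W_J\circ w: J\subseteq S, w\in X_J^{ -1}\}$. The weak Bruhat order $\le_B$ on $P^{(W,S)}$ is the reflexive transitive closure of: for $J\subseteq S$, $s\in S\setminus J$, $w\in X_{J\cup\{s\}}^{ -1}$, $W_J\circ w<_B W_{J\cup\{s\}}\circ w$ and $W_{J\cup\{s\}}\circ w<_B W_J\circ(\alpha_{J,s}^{ -1}\circ w)$. -}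

module Defs where

open import Level using (0ℓ)
open import Data.Nat using (ℕ; zero; suc; _+_; _≤_; _<_)
open import Data.Fin using (Fin)
open import Data.Fin.Subset using (Subset; _∈_; _∉_; _∪_; ⁅_⁆)
open import Data.List using (List; []; _∷_; foldr; length)
open import Data.List.Relation.Unary.All using (All)
import Data.List.Membership.Propositional as LM
open import Data.Product using (Σ; ∃; _×_; _,_)
open import Relation.Binary.PropositionalEquality using (_≡_; _≢_)
open import Relation.Binary.Construct.Closure.ReflexiveTransitive using (Star)
open import Algebra.Bundles using (Group)
open import Algebra.Structures using (IsGroup)
open import Function.Definitions using (Injective)

pow : {A : Set} → (A → A → A) → A → A → ℕ → A
pow _∙_ e x zero    = e
pow _∙_ e x (suc m) = x ∙ pow _∙_ e x m

-- W is a finite group (equality _≡_),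
-- S = { gen i | i : Fin n } a set of n distinct involutions generating W,
-- and W has the Coxeter presentation  < S | (s t)^{m} = 1 whenever (s t)^m = 1 in W >,
-- expressed by the universal property of the presentation.
record CoxeterSystem : Set₁ where
  field
    W       : Set
    _∙_     : W → W → W
    e       : W
    _⁻¹     : W → W
    isGroup : IsGroup _≡_ _∙_ e _⁻¹
    elems    : List W
    complete : ∀ w → w LM.∈ elems
    n       : ℕ
    gen     : Fin n → W
    gen-inj : Injective _≡_ _≡_ gen
    gen-nonid : ∀ i → gen i ≢ e
    gen-inv   : ∀ i → gen i ∙ gen i ≡ e

  prod : List (Fin n) → W
  prod = foldr (λ i acc → gen i ∙ acc) e

  field
    generates : ∀ w → ∃ λ (ws : List (Fin n)) → prod ws ≡ w
    presentation :
      (G : Group 0ℓ 0ℓ) (f : Fin n → Group.Carrier G) →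
      (∀ i j m → pow _∙_ e (gen i ∙ gen j) m ≡ e →
         Group._≈_ G (pow (Group._∙_ G) (Group.ε G) (Group._∙_ G (f i) (f j)) m) (Group.ε G)) →
      Σ (W → Group.Carrier G) λ φ →
        (∀ x y → Group._≈_ G (φ (x ∙ y)) (Group._∙_ G (φ x) (φ y))) ×
        (∀ i → Group._≈_ G (φ (gen i)) (f i))

module Coxeter (C : CoxeterSystem) where
  open CoxeterSystem C public

  Len : W → ℕ → Set
  Len w k = (∃ λ ws → length ws ≡ k × prod ws ≡ w) ×
            (∀ ws → prod ws ≡ w → k ≤ length ws)

  InW : Subset n → W → Set
  InW J w = ∃ λ ws → All (λ i → i ∈ J) ws × prod ws ≡ w

  InX : Subset n → W → Set
  InX J w = ∀ i → i ∈ J → ∀ k k' → Len w k → Len (w ∙ gen i) k' → k < k'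

  InXinv : Subset n → W → Set
  InXinv J w = InX J (w ⁻¹)

  _≤B_ : W → W → Set
  x ≤B x' = Σ W λ y → x' ≡ y ∙ x ×
            Σ ℕ λ a → Σ ℕ λ b → Σ ℕ λ c →
              Len x' a × Len y b × Len x c × a ≡ b + c

  IsLongest : W → Set
  IsLongest ω = ∀ w a b → Len w a → Len ω b → a ≤ b

  IsXi : Subset n → W → Set
  IsXi J ξ = InX J ξ × Σ W λ ωS → Σ W λ ωJ → IsLongest ωS × InW J ωJ × ωS ≡ ξ ∙ ωJ

  IsAlpha : Subset n → Fin n → W → Set
  IsAlpha J s α = InX J α × InW (J ∪ ⁅ s ⁆) α ×
    Σ W λ ξ → Σ W λ ξ' → IsXi J ξ × IsXi (J ∪ ⁅ s ⁆) ξ' × ξ ≡ ξ' ∙ α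

  -- elements of P^{(W,S)}: the coset W_J ∘ w is represented by the pair (J , w), w ∈ X_J^{-1}
  -- (the minimal coset representative determines the coset and vice versa)
  Coset : Set
  Coset = Subset n × W

  data Step : Coset → Coset → Set where
    up   : ∀ J s w → s ∉ J → InXinv (J ∪ ⁅ s ⁆) w →
           Step (J , w) (J ∪ ⁅ s ⁆ , w)
    down : ∀ J s w α → s ∉ J → InXinv (J ∪ ⁅ s ⁆) w → IsAlpha J s α →
           Step (J ∪ ⁅ s ⁆ , w) (J , (α ⁻¹) ∙ w)

  _≤P_ : Coset → Coset → Set
  _≤P_ = Star Step

{-# OPTIONS --safe #-}

-- The chain runs through the bottom parabolic W_∅.  Removing the generators of K one at a
-- time by steps W_{J∪{s}} c < W_J α_{J,s}⁻¹ c leads from W_K z to W_∅ ξ_∅⁻¹ ξ_K z = W_∅ ω_K z,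
-- since the α's telescope.  Inside W_∅, a length-raising left multiplication y ↦ s y is the
-- pair of steps W_∅ y < W_{s} y < W_∅ s y (with α_{∅,s} = s), so ω_K z ≤_B w lifts to
-- W_∅ ω_K z ≤ W_∅ w; adding the generators of J one at a time then climbs to W_J w.
-- The Coxeter theory this needs (minimal coset representatives are length-additive and are
-- characterised by their ascents) rests on the exchange condition, which is derived from the
-- presentation by Tits' argument: the reflections act on W × Bool, so the parity of the
-- number of times a word "crosses" a reflection t depends only on the element it represents.

module Submission where

open import Level using (0ℓ)
open import Algebra.Bundles using (Group)
open import Algebra.Structures using (IsGroup)
import Algebra.Properties.Group as GroupProperties
open import Data.Bool using (Bool; true; false; not; _xor_)
open import Data.Bool.Properties using (xor-assoc; xor-same; xor-identityʳ; not-involutive)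
open import Data.Empty using (⊥-elim)
open import Data.Nat using (ℕ; zero; suc; _+_; _≤_; _<_; z≤n; s≤s) renaming (_≟_ to _≟ℕ_)
open import Data.Nat.Properties
  using (≤-refl; ≤-reflexive; ≤-trans; ≤-antisym; ≤-pred; ≤-totalOrder; ≮⇒≥; <⇒≱; <-asym; 1+n≰n; n≤0⇒n≡0;
         m<1+n⇒m<n∨m≡n; 0≢1+n; +-identityʳ; +-suc; +-comm; +-assoc; +-monoʳ-≤; +-monoˡ-≤; +-monoʳ-<;
         +-cancelˡ-≡; +-cancelˡ-<; m+n≡0⇒m≡0; module ≤-Reasoning)
open import Data.Fin using (Fin; toℕ; fromℕ<) renaming (_≟_ to _≟ᶠ_)
open import Data.Fin.Properties using (any?; toℕ≤pred[n]; toℕ-fromℕ<)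
open import Data.Fin.Subset using (Subset; _∈_; _∉_; _⊆_; _⊂_; _∪_; ⁅_⁆; ⊥; _─_; _-_)
open import Data.Fin.Subset.Properties
  using (_∈?_; x∈p∪q⁻; x∈p∪q⁺; x∈⁅y⁆⇒x≡y; x∈⁅x⁆; p─q⊆p; x∈p∧x≢y⇒x∈p-y; ⊆-antisym; x∈p⇒p-x⊂p;
         Empty-unique; nonempty?; ∉⊥; p⊆p∪q; ∪-identityˡ)
open import Data.Fin.Subset.Induction using (⊂-wellFounded)
open import Data.List using (List; []; _∷_; _++_; _∷ʳ_; [_]; length; reverse)
open import Data.List.Extrema ≤-totalOrder using (argmax; f[xs]≤f[argmax])
open import Data.List.Properties
  using (length-++; length-reverse; unfold-reverse; ++-assoc; length-++-sucʳ; ∷-injective)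
open import Data.List.Reverse using (Reverse; []; _∶_∶ʳ_; reverseView)
open import Data.List.Relation.Unary.All as All using (All; []; _∷_)
import Data.List.Relation.Unary.All.Properties as AllP
import Data.List.Relation.Unary.Any as Any
import Data.List.Relation.Unary.Any.Properties as Any
open import Data.List.Membership.Setoid.Properties using (index-injective)
open import Data.Vec using (_∷_; there)
open import Data.Product using (Σ; ∃; _×_; _,_; proj₁; proj₂)
open import Data.Sum using (_⊎_; inj₁; inj₂)
open import Function.Base using (_∘_)
open import Function.Bundles using (Inverse; _↔_; _⇔_; mk⇔; mk↔ₛ′)
open import Function.Construct.Composition using (_↔-∘_)
open import Function.Construct.Identity using (↔-id)
open import Function.Construct.Symmetry using (↔-sym)
open import Induction.WellFounded using (module All)
open import Relation.Binary.Construct.Closure.ReflexiveTransitive using (ε; _◅_; _◅◅_)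
open import Relation.Binary.Definitions using (DecidableEquality)
open import Relation.Nullary using (Dec; yes; no; ¬_)
open import Relation.Nullary.Reflects using (Reflects; invert)
open import Relation.Nullary.Decidable using (_×-dec_; map′; does; does-⇔; dec-true)
open import Relation.Binary.PropositionalEquality hiding ([_])
open import Defs

xorUpTo : (ℕ → Bool) → ℕ → Bool
xorUpTo f zero    = false
xorUpTo f (suc k) = xorUpTo f k xor f k

xorUpTo-cong : ∀ {f g} → (∀ k → f k ≡ g k) → ∀ m → xorUpTo f m ≡ xorUpTo g m
xorUpTo-cong f≗g zero    = refl
xorUpTo-cong f≗g (suc m) = cong₂ _xor_ (xorUpTo-cong f≗g m) (f≗g m)

xorUpTo-+ : ∀ f m k → xorUpTo f (m + k) ≡ xorUpTo f m xor xorUpTo (λ l → f (m + l)) k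
xorUpTo-+ f m zero    = trans (cong (xorUpTo f) (+-identityʳ m)) (sym (xor-identityʳ _))
xorUpTo-+ f m (suc k) = begin
  xorUpTo f (m + suc k)                                          ≡⟨ cong (xorUpTo f) (+-suc m k) ⟩
  xorUpTo f (m + k) xor f (m + k)                                ≡⟨ cong (_xor f (m + k)) (xorUpTo-+ f m k) ⟩
  (xorUpTo f m xor xorUpTo (λ l → f (m + l)) k) xor f (m + k)    ≡⟨ xor-assoc (xorUpTo f m) _ _ ⟩
  xorUpTo f m xor xorUpTo (λ l → f (m + l)) (suc k)              ∎
  where open ≡-Reasoning

xorUpTo-periodic : ∀ {f} m → (∀ k → f (m + k) ≡ f k) → xorUpTo f (m + m) ≡ false
xorUpTo-periodic {f} m periodic = begin
  xorUpTo f (m + m)                                 ≡⟨ xorUpTo-+ f m m ⟩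
  xorUpTo f m xor xorUpTo (λ l → f (m + l)) m       ≡⟨ cong (xorUpTo f m xor_) (xorUpTo-cong periodic m) ⟩
  xorUpTo f m xor xorUpTo f m                       ≡⟨ xor-same (xorUpTo f m) ⟩
  false                                             ∎
  where open ≡-Reasoning

length-∷ʳ : ∀ {A : Set} (xs : List A) x → length (xs ∷ʳ x) ≡ suc (length xs)
length-∷ʳ xs x = trans (length-++ xs) (+-comm (length xs) 1)

split-++-∷ : ∀ {A : Set} (xs ys as : List A) {b} bs → xs ++ ys ≡ as ++ b ∷ bs →
  (∃ λ cs → xs ≡ as ++ b ∷ cs × bs ≡ cs ++ ys) ⊎ (∃ λ cs → ys ≡ cs ++ b ∷ bs × as ≡ xs ++ cs)
split-++-∷ []       ys as       bs eq = inj₂ (as , eq , refl)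
split-++-∷ (x ∷ xs) ys []       bs eq with refl , eq′ ← ∷-injective eq = inj₁ (xs , refl , sym eq′)
split-++-∷ (x ∷ xs) ys (a ∷ as) bs eq with refl , eq′ ← ∷-injective eq with split-++-∷ xs ys as bs eq′
... | inj₁ (cs , p , q) = inj₁ (cs , cong (x ∷_) p , q)
... | inj₂ (cs , p , q) = inj₂ (cs , p , cong (x ∷_) q)

x∈p─q⇒x∉q : ∀ {m} {x : Fin m} (p q : Subset m) → x ∈ p ─ q → x ∉ q
x∈p─q⇒x∉q (_ ∷ p) (_ ∷ q) (there x∈p─q) (there x∈q) = x∈p─q⇒x∉q p q x∈p─q x∈q

module _ {m : ℕ} where

  x∉p-x : ∀ (p : Subset m) x → x ∉ p - x
  x∉p-x p x x∈p-x = x∈p─q⇒x∉q p ⁅ x ⁆ x∈p-x (x∈⁅x⁆ x)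

  p-x∪⁅x⁆≡p : ∀ {p : Subset m} {x} → x ∈ p → (p - x) ∪ ⁅ x ⁆ ≡ p
  p-x∪⁅x⁆≡p {p} {x} x∈p = ⊆-antisym ⊆p ⊇p
    where
    ⊆p : ∀ {y} → y ∈ (p - x) ∪ ⁅ x ⁆ → y ∈ p
    ⊆p y∈ with x∈p∪q⁻ (p - x) ⁅ x ⁆ y∈
    ... | inj₁ y∈p-x = p─q⊆p p ⁅ x ⁆ y∈p-x
    ... | inj₂ y∈⁅x⁆ = subst (_∈ p) (sym (x∈⁅y⁆⇒x≡y x y∈⁅x⁆)) x∈p
    ⊇p : ∀ {y} → y ∈ p → y ∈ (p - x) ∪ ⁅ x ⁆
    ⊇p {y} y∈p with y ≟ᶠ x
    ... | yes refl = x∈p∪q⁺ (inj₂ (x∈⁅x⁆ x))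
    ... | no y≢x   = x∈p∪q⁺ (inj₁ (x∈p∧x≢y⇒x∈p-y y∈p y≢x))

  ∪⁅⁆-induction : (P : Subset m → Set) → P ⊥ → (∀ J s → s ∉ J → P J → P (J ∪ ⁅ s ⁆)) → ∀ J → P J
  ∪⁅⁆-induction P P⊥ P∪ = All.wfRec ⊂-wellFounded _ P step
    where
    step : ∀ J → (∀ {J′} → J′ ⊂ J → P J′) → P J
    step J rec with nonempty? J
    ... | no empty      = subst P (sym (Empty-unique empty)) P⊥
    ... | yes (s , s∈J) = subst P (p-x∪⁅x⁆≡p s∈J) (P∪ (J - s) s (x∉p-x J s) (rec (x∈p⇒p-x⊂p s∈J)))

Least : (ℕ → Set) → ℕ → Set
Least P k = P k × (∀ j → P j → k ≤ j)

module _ {P : ℕ → Set} (P? : ∀ k → Dec (P k)) where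

  least-below? : ∀ k → (∃ (Least P)) ⊎ (∀ j → j < k → ¬ P j)
  least-below? zero = inj₂ (λ _ ())
  least-below? (suc k) with least-below? k
  ... | inj₁ found = inj₁ found
  ... | inj₂ none with P? k
  ...   | yes Pk = inj₁ (k , Pk , λ j Pj → ≮⇒≥ (λ j<k → none j j<k Pj))
  ...   | no ¬Pk = inj₂ below
    where
    below : ∀ j → j < suc k → ¬ P j
    below j j<1+k with m<1+n⇒m<n∨m≡n j<1+k
    ... | inj₁ j<k  = none j j<k
    ... | inj₂ refl = ¬Pk

  least : ∀ {k} → P k → ∃ (Least P)
  least {k} Pk with least-below? (suc k)
  ... | inj₁ found = found
  ... | inj₂ none  = ⊥-elim (none k ≤-refl Pk)

any-of-length? : ∀ {m} (Q : List (Fin m) → Set) → (∀ ws → Dec (Q ws)) →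
                 ∀ k → Dec (∃ λ ws → length ws ≡ k × Q ws)
any-of-length? Q Q? zero with Q? []
... | yes q = yes ([] , refl , q)
... | no ¬q = no λ { ([] , _ , q) → ¬q q ; (_ ∷ _ , () , _) }
any-of-length? Q Q? (suc k) with any? (λ i → any-of-length? (λ ws → Q (i ∷ ws)) (λ ws → Q? (i ∷ ws)) k)
... | yes (i , ws , refl , q) = yes (i ∷ ws , refl , q)
... | no none = no λ { ([] , () , _) ; (i ∷ ws , refl , q) → none (i , ws , refl , q) }

any-of-length≤? : ∀ {m} (Q : List (Fin m) → Set) → (∀ ws → Dec (Q ws)) →
                  ∀ k → Dec (∃ λ ws → length ws ≤ k × Q ws)
any-of-length≤? Q Q? k = map′ from to (any? (λ (i : Fin (suc k)) → any-of-length? Q Q? (toℕ i)))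
  where
  from : (∃ λ (i : Fin (suc k)) → ∃ λ ws → length ws ≡ toℕ i × Q ws) → ∃ λ ws → length ws ≤ k × Q ws
  from (i , ws , length≡i , q) = ws , subst (_≤ k) (sym length≡i) (toℕ≤pred[n] i) , q
  to : (∃ λ ws → length ws ≤ k × Q ws) → ∃ λ (i : Fin (suc k)) → ∃ λ ws → length ws ≡ toℕ i × Q ws
  to (ws , length≤k , q) = fromℕ< (s≤s length≤k) , ws , sym (toℕ-fromℕ< (s≤s length≤k)) , q

_≗↔_ : {A : Set} → A ↔ A → A ↔ A → Set
f ≗↔ g = ∀ x → Inverse.to f x ≡ Inverse.to g x

symmetricGroup : Set → Group 0ℓ 0ℓ
symmetricGroup A = record
  { Carrier = A ↔ A
  ; _≈_     = _≗↔_
  ; _∙_     = _↔-∘_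
  ; ε       = ↔-id A
  ; _⁻¹     = ↔-sym
  ; isGroup = record
    { isMonoid = record
      { isSemigroup = record
        { isMagma = record
          { isEquivalence = record
            { refl  = λ _ → refl
            ; sym   = λ f≗g x → sym (f≗g x)
            ; trans = λ f≗g g≗h x → trans (f≗g x) (g≗h x) }
          ; ∙-cong = λ {f} {_} {_} {g′} f≗f′ g≗g′ x → trans (cong (to f) (g≗g′ x)) (f≗f′ (to g′ x)) }
        ; assoc = λ _ _ _ _ → refl }
      ; identity = (λ _ _ → refl) , (λ _ _ → refl) }
    ; inverse = (λ f → strictlyInverseʳ f) , (λ f → strictlyInverseˡ f)
    ; ⁻¹-cong = λ {f} {g} f≗g y → begin
        from f y                  ≡⟨ cong (from f) (strictlyInverseˡ g y) ⟨
        from f (to g (from g y))  ≡⟨ cong (from f) (f≗g (from g y)) ⟨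
        from f (to f (from g y))  ≡⟨ strictlyInverseʳ f (from g y) ⟩
        from g y                  ∎ } }
  where
  open Inverse
  open ≡-Reasoning

module CoxeterTheory (C : CoxeterSystem) where
  open Coxeter C public renaming (_∙_ to infixr 7 _·_)

  group : Group 0ℓ 0ℓ
  group = record { Carrier = W ; _≈_ = _≡_ ; _∙_ = _·_ ; ε = e ; _⁻¹ = _⁻¹ ; isGroup = isGroup }

  open IsGroup isGroup using (assoc; identityˡ; identityʳ; inverseˡ; inverseʳ)
  open GroupProperties group
    using (⁻¹-involutive; ⁻¹-anti-homo-∙; ε⁻¹≈ε; inverseʳ-unique; ∙-cancelˡ;
           \\-leftDividesˡ; \\-leftDividesʳ; //-rightDividesˡ; //-rightDividesʳ)
  open import Algebra.Solver.Monoid (Group.monoid group) using (solve; _⊜_; _⊕_)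

  gen⁻¹ : ∀ i → gen i ⁻¹ ≡ gen i
  gen⁻¹ i = sym (inverseʳ-unique (gen i) (gen i) (gen-inv i))

  gen-gen-· : ∀ i x → gen i · gen i · x ≡ x
  gen-gen-· i x = trans (sym (assoc _ _ _)) (trans (cong (_· x) (gen-inv i)) (identityˡ x))

  ·-gen-gen : ∀ i x → (x · gen i) · gen i ≡ x
  ·-gen-gen i x = trans (assoc _ _ _) (trans (cong (x ·_) (gen-inv i)) (identityʳ x))

  Word : Set
  Word = List (Fin n)

  prod-++ : ∀ xs ys → prod (xs ++ ys) ≡ prod xs · prod ys
  prod-++ []       ys = sym (identityˡ _)
  prod-++ (x ∷ xs) ys = trans (cong (gen x ·_) (prod-++ xs ys)) (sym (assoc _ _ _))

  prod-∷ʳ : ∀ xs a → prod (xs ∷ʳ a) ≡ prod xs · gen a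
  prod-∷ʳ xs a = trans (prod-++ xs [ a ]) (cong (prod xs ·_) (identityʳ (gen a)))

  prod-reverse : ∀ xs → prod (reverse xs) ≡ prod xs ⁻¹
  prod-reverse []       = sym ε⁻¹≈ε
  prod-reverse (x ∷ xs) = begin
    prod (reverse (x ∷ xs))       ≡⟨ cong prod (unfold-reverse x xs) ⟩
    prod (reverse xs ∷ʳ x)        ≡⟨ prod-∷ʳ (reverse xs) x ⟩
    prod (reverse xs) · gen x     ≡⟨ cong₂ _·_ (prod-reverse xs) (sym (gen⁻¹ x)) ⟩
    prod xs ⁻¹ · gen x ⁻¹         ≡⟨ ⁻¹-anti-homo-∙ (gen x) (prod xs) ⟨
    (gen x · prod xs) ⁻¹          ∎
    where open ≡-Reasoning

  All-reverse : ∀ {P : Fin n → Set} {xs} → All P xs → All P (reverse xs)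
  All-reverse Pxs = All.tabulate (λ x∈ → All.lookup Pxs (Any.reverse⁻ x∈))

  InW-· : ∀ {J u v} → InW J u → InW J v → InW J (u · v)
  InW-· (us , Jus , refl) (vs , Jvs , refl) = us ++ vs , AllP.++⁺ Jus Jvs , prod-++ us vs

  InW-⁻¹ : ∀ {J v} → InW J v → InW J (v ⁻¹)
  InW-⁻¹ (vs , Jvs , refl) = reverse vs , All-reverse Jvs , prod-reverse vs

  InW-gen : ∀ {J i} → i ∈ J → InW J (gen i)
  InW-gen {i = i} i∈J = [ i ] , i∈J ∷ [] , identityʳ (gen i)

  InW-mono : ∀ {J J′ v} → J ⊆ J′ → InW J v → InW J′ v
  InW-mono J⊆J′ (vs , Jvs , p) = vs , All.map J⊆J′ Jvs , p

  InW-⊥ : ∀ {v} → InW ⊥ v → v ≡ e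
  InW-⊥ ([]    , _        , p) = sym p
  InW-⊥ (_ ∷ _ , i∈⊥ ∷ _ , _) = ⊥-elim (∉⊥ i∈⊥)

  infix 4 _≟_
  _≟_ : DecidableEquality W
  x ≟ y = map′ (index-injective (setoid W) (complete x) (complete y))
               (cong (λ v → Any.index (complete v)))
               (Any.index (complete x) ≟ᶠ Any.index (complete y))

  HasWordOfLength : W → ℕ → Set
  HasWordOfLength w k = ∃ λ ws → length ws ≡ k × prod ws ≡ w

  opaque
    shortest : ∀ w → ∃ (Least (HasWordOfLength w))
    shortest w = least (any-of-length? (λ ws → prod ws ≡ w) (λ ws → prod ws ≟ w))
                       (proj₁ (generates w) , refl , proj₂ (generates w))

  ℓ : W → ℕ
  ℓ w = proj₁ (shortest w)

  reducedWord : W → Word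
  reducedWord w = proj₁ (proj₁ (proj₂ (shortest w)))

  length-reducedWord : ∀ w → length (reducedWord w) ≡ ℓ w
  length-reducedWord w = proj₁ (proj₂ (proj₁ (proj₂ (shortest w))))

  prod-reducedWord : ∀ w → prod (reducedWord w) ≡ w
  prod-reducedWord w = proj₂ (proj₂ (proj₁ (proj₂ (shortest w))))

  ℓ-minimal : ∀ {w} ws → prod ws ≡ w → ℓ w ≤ length ws
  ℓ-minimal {w} ws p = proj₂ (proj₂ (shortest w)) _ (ws , refl , p)

  ℓ-Len : ∀ w → Len w (ℓ w)
  ℓ-Len w = proj₁ (proj₂ (shortest w)) , ℓ-minimal

  Len⇒≡ℓ : ∀ {w k} → Len w k → k ≡ ℓ w
  Len⇒≡ℓ {w} ((ws , refl , p) , minimal) =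
    ≤-antisym (subst (_ ≤_) (length-reducedWord w) (minimal (reducedWord w) (prod-reducedWord w))) (ℓ-minimal ws p)

  ℓ-prod : ∀ ws → ℓ (prod ws) ≤ length ws
  ℓ-prod ws = ℓ-minimal ws refl

  ℓ≡0⇒≡e : ∀ {w} → ℓ w ≡ 0 → w ≡ e
  ℓ≡0⇒≡e {w} ℓw≡0 with reducedWord w | length-reducedWord w | prod-reducedWord w
  ... | []    | _    | p = sym p
  ... | _ ∷ _ | ℓw≡1+ | _ = ⊥-elim (0≢1+n (trans (sym ℓw≡0) (sym ℓw≡1+)))

  ℓ-· : ∀ x y → ℓ (x · y) ≤ ℓ x + ℓ y
  ℓ-· x y = subst (ℓ (x · y) ≤_) length≡ (ℓ-minimal (reducedWord x ++ reducedWord y) prod≡)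
    where
    prod≡ : prod (reducedWord x ++ reducedWord y) ≡ x · y
    prod≡ = trans (prod-++ (reducedWord x) (reducedWord y)) (cong₂ _·_ (prod-reducedWord x) (prod-reducedWord y))
    length≡ : length (reducedWord x ++ reducedWord y) ≡ ℓ x + ℓ y
    length≡ = trans (length-++ (reducedWord x)) (cong₂ _+_ (length-reducedWord x) (length-reducedWord y))

  ℓ-⁻¹≤ : ∀ w → ℓ (w ⁻¹) ≤ ℓ w
  ℓ-⁻¹≤ w = subst (ℓ (w ⁻¹) ≤_) length≡ (ℓ-minimal (reverse (reducedWord w)) prod≡)
    where
    prod≡ : prod (reverse (reducedWord w)) ≡ w ⁻¹
    prod≡ = trans (prod-reverse (reducedWord w)) (cong _⁻¹ (prod-reducedWord w))
    length≡ : length (reverse (reducedWord w)) ≡ ℓ w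
    length≡ = trans (length-reverse (reducedWord w)) (length-reducedWord w)

  ℓ-⁻¹ : ∀ w → ℓ (w ⁻¹) ≡ ℓ w
  ℓ-⁻¹ w = ≤-antisym (ℓ-⁻¹≤ w) (subst (λ u → ℓ u ≤ ℓ (w ⁻¹)) (⁻¹-involutive w) (ℓ-⁻¹≤ (w ⁻¹)))

  ℓ-gen : ∀ i → ℓ (gen i) ≤ 1
  ℓ-gen i = ℓ-minimal [ i ] (identityʳ _)

  ℓ-·gen : ∀ w i → ℓ (w · gen i) ≤ suc (ℓ w)
  ℓ-·gen w i = ≤-trans (ℓ-· w (gen i)) (≤-trans (+-monoʳ-≤ (ℓ w) (ℓ-gen i)) (≤-reflexive (+-comm (ℓ w) 1)))

  ℓ-gen· : ∀ w i → ℓ (gen i · w) ≤ suc (ℓ w)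
  ℓ-gen· w i = ≤-trans (ℓ-· (gen i) w) (+-monoˡ-≤ (ℓ w) (ℓ-gen i))

  ℓ≤ℓ-·gen : ∀ w i → ℓ w ≤ suc (ℓ (w · gen i))
  ℓ≤ℓ-·gen w i = subst (λ u → ℓ u ≤ suc (ℓ (w · gen i))) (·-gen-gen i w) (ℓ-·gen (w · gen i) i)

  RightAscents : Subset n → W → Set
  RightAscents J w = ∀ i → i ∈ J → ℓ w < ℓ (w · gen i)

  InX⇒RightAscents : ∀ {J w} → InX J w → RightAscents J w
  InX⇒RightAscents x i i∈J = x i i∈J _ _ (ℓ-Len _) (ℓ-Len _)

  RightAscents⇒InX : ∀ {J w} → RightAscents J w → InX J w
  RightAscents⇒InX asc i i∈J k k′ Lk Lk′ = subst₂ _<_ (sym (Len⇒≡ℓ Lk)) (sym (Len⇒≡ℓ Lk′)) (asc i i∈J)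

  IsLongest⇒ℓ≤ : ∀ {ω} → IsLongest ω → ∀ y → ℓ y ≤ ℓ ω
  IsLongest⇒ℓ≤ longest y = longest y _ _ (ℓ-Len y) (ℓ-Len _)

  ℓ≤⇒IsLongest : ∀ {ω} → (∀ y → ℓ y ≤ ℓ ω) → IsLongest ω
  ℓ≤⇒IsLongest ℓ≤ y a b La Lb = subst₂ _≤_ (sym (Len⇒≡ℓ La)) (sym (Len⇒≡ℓ Lb)) (ℓ≤ y)

  -- The reflection representation and the exchange condition

  conjugate-inverse : ∀ a t → a ⁻¹ · (a · t · a ⁻¹) · a ≡ t
  conjugate-inverse a t = begin
    a ⁻¹ · (a · t · a ⁻¹) · a
      ≡⟨ solve 3 (λ x y z → x ⊕ ((z ⊕ (y ⊕ x)) ⊕ z) ⊜ (x ⊕ z) ⊕ y ⊕ (x ⊕ z)) refl (a ⁻¹) t a ⟩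
    (a ⁻¹ · a) · t · (a ⁻¹ · a)  ≡⟨ cong₂ (λ u v → u · t · v) (inverseˡ a) (inverseˡ a) ⟩
    e · t · e                    ≡⟨ trans (identityˡ _) (identityʳ t) ⟩
    t                            ∎
    where open ≡-Reasoning

  conjugate-e : ∀ t → e · t · e ⁻¹ ≡ t
  conjugate-e t = trans (identityˡ _) (trans (cong (t ·_) ε⁻¹≈ε) (identityʳ t))

  conjugate-≡ : ∀ a t c → (a · t · a ⁻¹ ≡ c) ⇔ (t ≡ a ⁻¹ · c · a)
  conjugate-≡ a t c = mk⇔ (λ p → trans (sym (conjugate-inverse a t)) (cong (λ u → a ⁻¹ · u · a) p))
                          (λ q → trans (cong (λ u → a · u · a ⁻¹) q) inverse-conjugate)
    where
    inverse-conjugate : a · (a ⁻¹ · c · a) · a ⁻¹ ≡ c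
    inverse-conjugate = subst (λ b → b · (a ⁻¹ · c · b) · a ⁻¹ ≡ c) (⁻¹-involutive a) (conjugate-inverse (a ⁻¹) c)

  infix 4 _==_
  _==_ : W → W → Bool
  x == y = does (x ≟ y)

  ==⇒≡ : ∀ {x y} → (x == y) ≡ true → x ≡ y
  ==⇒≡ {x} {y} x==y = invert (subst (Reflects (x ≡ y)) x==y (Dec.proof (x ≟ y)))

  ==-conjugate : ∀ a t c → (a · t · a ⁻¹ == c) ≡ (t == a ⁻¹ · c · a)
  ==-conjugate a t c = does-⇔ (conjugate-≡ a t c) (a · t · a ⁻¹ ≟ c) (t ≟ a ⁻¹ · c · a)

  ==-conjugate-gen : ∀ i t c → (gen i · t · gen i == c) ≡ (t == gen i · c · gen i)
  ==-conjugate-gen i t c =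
    subst (λ g → (gen i · t · g == c) ≡ (t == g · c · gen i)) (gen⁻¹ i) (==-conjugate (gen i) t c)

  reflectionParity : Word → W → Bool
  reflectionParity []       t = false
  reflectionParity (a ∷ ws) t = reflectionParity ws t xor (t == prod ws ⁻¹ · gen a · prod ws)

  reflect : Fin n → W × Bool → W × Bool
  reflect a (t , b) = gen a · t · gen a , b xor (t == gen a)

  reflect-involutive : ∀ a p → reflect a (reflect a p) ≡ p
  reflect-involutive a (t , b) = cong₂ _,_ conj² parity²
    where
    conj² : gen a · (gen a · t · gen a) · gen a ≡ t
    conj² = subst (λ g → g · (gen a · t · g) · gen a ≡ t) (gen⁻¹ a) (conjugate-inverse (gen a) t)
    parity² : (b xor (t == gen a)) xor (gen a · t · gen a == gen a) ≡ b
    parity² = begin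
      (b xor (t == gen a)) xor (gen a · t · gen a == gen a)
        ≡⟨ cong ((b xor (t == gen a)) xor_) (==-conjugate-gen a t (gen a)) ⟩
      (b xor (t == gen a)) xor (t == gen a · gen a · gen a)
        ≡⟨ cong (λ u → (b xor (t == gen a)) xor (t == u)) (gen-gen-· a (gen a)) ⟩
      (b xor (t == gen a)) xor (t == gen a)                  ≡⟨ xor-assoc b _ _ ⟩
      b xor ((t == gen a) xor (t == gen a))                  ≡⟨ cong (b xor_) (xor-same (t == gen a)) ⟩
      b xor false                                            ≡⟨ xor-identityʳ b ⟩
      b                                                      ∎
      where open ≡-Reasoning

  reflection↔ : Fin n → (W × Bool) ↔ (W × Bool)
  reflection↔ a = mk↔ₛ′ (reflect a) (reflect a) (reflect-involutive a) (reflect-involutive a)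

  act : Word → W × Bool → W × Bool
  act []       p = p
  act (a ∷ ws) p = reflect a (act ws p)

  act-prod : ∀ ws t b → act ws (t , b) ≡ (prod ws · t · prod ws ⁻¹ , b xor reflectionParity ws t)
  act-prod []       t b = cong₂ _,_ (sym (conjugate-e t)) (sym (xor-identityʳ b))
  act-prod (a ∷ ws) t b = begin
    reflect a (act ws (t , b))                                   ≡⟨ cong (reflect a) (act-prod ws t b) ⟩
    reflect a (P · t · P ⁻¹ , b xor reflectionParity ws t)      ≡⟨ cong₂ _,_ conj parity ⟩
    ((gen a · P) · t · (gen a · P) ⁻¹ ,
      b xor (reflectionParity ws t xor (t == P ⁻¹ · gen a · P)))  ∎
    where
    open ≡-Reasoning
    P : W
    P = prod ws
    conj : gen a · (P · t · P ⁻¹) · gen a ≡ (gen a · P) · t · (gen a · P) ⁻¹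
    conj = begin
      gen a · (P · t · P ⁻¹) · gen a
        ≡⟨ solve 4 (λ x y z w → x ⊕ ((y ⊕ (z ⊕ w)) ⊕ x) ⊜ (x ⊕ y) ⊕ (z ⊕ (w ⊕ x))) refl (gen a) P t (P ⁻¹) ⟩
      (gen a · P) · t · P ⁻¹ · gen a    ≡⟨ cong (λ g → (gen a · P) · t · P ⁻¹ · g) (gen⁻¹ a) ⟨
      (gen a · P) · t · P ⁻¹ · gen a ⁻¹ ≡⟨ cong (λ u → (gen a · P) · t · u) (⁻¹-anti-homo-∙ (gen a) P) ⟨
      (gen a · P) · t · (gen a · P) ⁻¹  ∎
    parity : (b xor reflectionParity ws t) xor (P · t · P ⁻¹ == gen a)
           ≡ b xor (reflectionParity ws t xor (t == P ⁻¹ · gen a · P))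
    parity = trans (cong ((b xor reflectionParity ws t) xor_) (==-conjugate P t (gen a))) (xor-assoc b _ _)

  _^_ : W → ℕ → W
  x ^ m = pow _·_ e x m

  ^-+ : ∀ x m k → x ^ (m + k) ≡ x ^ m · x ^ k
  ^-+ x zero    k = sym (identityˡ _)
  ^-+ x (suc m) k = trans (cong (x ·_) (^-+ x m k)) (sym (assoc _ _ _))

  ^-comm : ∀ x m → x ^ m · x ≡ x · x ^ m
  ^-comm x zero    = trans (identityˡ x) (sym (identityʳ x))
  ^-comm x (suc m) = trans (assoc _ _ _) (cong (x ·_) (^-comm x m))

  ^-⁻¹ : ∀ x m → (x ^ m) ⁻¹ ≡ (x ⁻¹) ^ m
  ^-⁻¹ x zero    = ε⁻¹≈ε
  ^-⁻¹ x (suc m) = trans (⁻¹-anti-homo-∙ x (x ^ m)) (trans (cong (_· x ⁻¹) (^-⁻¹ x m)) (^-comm (x ⁻¹) m))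

  module Dihedral (i j : Fin n) where

    Q R : W
    Q = gen i · gen j
    R = gen j · gen i

    Q⁻¹≡R : Q ⁻¹ ≡ R
    Q⁻¹≡R = trans (⁻¹-anti-homo-∙ (gen i) (gen j)) (cong₂ _·_ (gen⁻¹ j) (gen⁻¹ i))

    Q^m⁻¹≡R^m : ∀ m → (Q ^ m) ⁻¹ ≡ R ^ m
    Q^m⁻¹≡R^m m = trans (^-⁻¹ Q m) (cong (_^ m) Q⁻¹≡R)

    j·Q^m≡R^m·j : ∀ m → gen j · Q ^ m ≡ R ^ m · gen j
    j·Q^m≡R^m·j zero    = trans (identityʳ _) (sym (identityˡ _))
    j·Q^m≡R^m·j (suc m) = begin
      gen j · Q · Q ^ m
        ≡⟨ solve 3 (λ x y z → x ⊕ ((y ⊕ x) ⊕ z) ⊜ (x ⊕ y) ⊕ (x ⊕ z)) refl (gen j) (gen i) (Q ^ m) ⟩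
      R · gen j · Q ^ m       ≡⟨ cong (R ·_) (j·Q^m≡R^m·j m) ⟩
      R · R ^ m · gen j       ≡⟨ assoc _ _ _ ⟨
      (R · R ^ m) · gen j     ∎
      where open ≡-Reasoning

    alternating : ℕ → Word
    alternating zero    = []
    alternating (suc m) = i ∷ j ∷ alternating m

    prod-alternating : ∀ m → prod (alternating m) ≡ Q ^ m
    prod-alternating zero    = refl
    prod-alternating (suc m) = trans (cong (λ u → gen i · gen j · u) (prod-alternating m)) (sym (assoc _ _ _))

    reflectionAt : W → ℕ → Bool
    reflectionAt t k = t == R ^ k · gen j

    even-reflection : ∀ m → (Q ^ m) ⁻¹ · gen j · Q ^ m ≡ R ^ (m + m) · gen j
    even-reflection m = begin
      (Q ^ m) ⁻¹ · gen j · Q ^ m    ≡⟨ cong₂ _·_ (Q^m⁻¹≡R^m m) (j·Q^m≡R^m·j m) ⟩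
      R ^ m · R ^ m · gen j         ≡⟨ assoc _ _ _ ⟨
      (R ^ m · R ^ m) · gen j       ≡⟨ cong (_· gen j) (^-+ R m m) ⟨
      R ^ (m + m) · gen j           ∎
      where open ≡-Reasoning

    odd-reflection : ∀ m → (gen j · Q ^ m) ⁻¹ · gen i · gen j · Q ^ m ≡ R ^ suc (m + m) · gen j
    odd-reflection m = begin
      (gen j · Q ^ m) ⁻¹ · gen i · gen j · Q ^ m
        ≡⟨ cong (λ u → u · gen i · gen j · Q ^ m) (⁻¹-anti-homo-∙ (gen j) (Q ^ m)) ⟩
      ((Q ^ m) ⁻¹ · gen j ⁻¹) · gen i · gen j · Q ^ m
        ≡⟨ cong₂ (λ u g → (u · g) · gen i · gen j · Q ^ m) (Q^m⁻¹≡R^m m) (gen⁻¹ j) ⟩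
      (R ^ m · gen j) · gen i · gen j · Q ^ m
        ≡⟨ solve 4 (λ x y z w → (x ⊕ y) ⊕ z ⊕ y ⊕ w ⊜ x ⊕ (y ⊕ z) ⊕ (y ⊕ w)) refl (R ^ m) (gen j) (gen i) (Q ^ m) ⟩
      R ^ m · R · gen j · Q ^ m                           ≡⟨ cong (λ u → R ^ m · R · u) (j·Q^m≡R^m·j m) ⟩
      R ^ m · R · R ^ m · gen j                           ≡⟨ cong (R ^ m ·_) (assoc _ _ _) ⟨
      R ^ m · R ^ suc m · gen j                           ≡⟨ assoc _ _ _ ⟨
      (R ^ m · R ^ suc m) · gen j                         ≡⟨ cong (_· gen j) (^-+ R m (suc m)) ⟨
      R ^ (m + suc m) · gen j                             ≡⟨ cong (λ k → R ^ k · gen j) (+-suc m m) ⟩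
      R ^ suc (m + m) · gen j                             ∎
      where open ≡-Reasoning

    reflectionParity-alternating : ∀ m t → reflectionParity (alternating m) t ≡ xorUpTo (reflectionAt t) (m + m)
    reflectionParity-alternating zero    t = refl
    reflectionParity-alternating (suc m) t
      rewrite reflectionParity-alternating m t | prod-alternating m | even-reflection m | odd-reflection m
      = cong (λ k → xorUpTo (reflectionAt t) (suc k)) (sym (+-suc m m))

    -- Read from the right, (i j)ᵐ crosses the reflections Rᵏ j for k < 2m; when (i j)ᵐ = 1
    -- this list is two copies of its first half.
    reflectionParity-alternating≡false : ∀ m t → Q ^ m ≡ e → reflectionParity (alternating m) t ≡ false
    reflectionParity-alternating≡false m t Q^m≡e =
      trans (reflectionParity-alternating m t) (xorUpTo-periodic m periodic)
      where
      R^m≡e : R ^ m ≡ e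
      R^m≡e = trans (sym (Q^m⁻¹≡R^m m)) (trans (cong _⁻¹ Q^m≡e) ε⁻¹≈ε)
      periodic : ∀ k → reflectionAt t (m + k) ≡ reflectionAt t k
      periodic k = cong (λ u → t == u · gen j) (trans (^-+ R m k) (trans (cong (_· R ^ k) R^m≡e) (identityˡ _)))

    to-pow-reflection↔ : ∀ m p → Inverse.to (pow _↔-∘_ (↔-id _) (reflection↔ i ↔-∘ reflection↔ j) m) p
                                ≡ act (alternating m) p
    to-pow-reflection↔ zero    p = refl
    to-pow-reflection↔ (suc m) p = cong (λ q → reflect i (reflect j q)) (to-pow-reflection↔ m p)

    reflection↔-relation : ∀ m → Q ^ m ≡ e → pow _↔-∘_ (↔-id _) (reflection↔ i ↔-∘ reflection↔ j) m ≗↔ ↔-id _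
    reflection↔-relation m Q^m≡e (t , b) = begin
      Inverse.to (pow _↔-∘_ (↔-id _) (reflection↔ i ↔-∘ reflection↔ j) m) (t , b)
        ≡⟨ to-pow-reflection↔ m (t , b) ⟩
      act (alternating m) (t , b)
        ≡⟨ act-prod (alternating m) t b ⟩
      (P · t · P ⁻¹ , b xor reflectionParity (alternating m) t)
        ≡⟨ cong₂ _,_ conj parity ⟩
      (t , b)
        ∎
      where
      open ≡-Reasoning
      P : W
      P = prod (alternating m)
      P≡e : P ≡ e
      P≡e = trans (prod-alternating m) Q^m≡e
      conj : P · t · P ⁻¹ ≡ t
      conj = trans (cong (λ u → u · t · u ⁻¹) P≡e) (conjugate-e t)
      parity : b xor reflectionParity (alternating m) t ≡ b
      parity = trans (cong (b xor_) (reflectionParity-alternating≡false m t Q^m≡e)) (xor-identityʳ b)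

  -- Tits' argument: by the Coxeter presentation the reflections generate a representation φ
  -- of W, and φ (prod ws) records the parity of ws, which therefore depends only on prod ws.
  reflectionRepresentation : Σ (W → (W × Bool) ↔ (W × Bool)) λ φ →
    (∀ x y → φ (x · y) ≗↔ (φ x ↔-∘ φ y)) × (∀ i → φ (gen i) ≗↔ reflection↔ i)
  reflectionRepresentation =
    presentation (symmetricGroup (W × Bool)) reflection↔ (λ i j m → Dihedral.reflection↔-relation i j m)

  φ : W → (W × Bool) ↔ (W × Bool)
  φ = proj₁ reflectionRepresentation

  φ-hom : ∀ x y → φ (x · y) ≗↔ (φ x ↔-∘ φ y)
  φ-hom = proj₁ (proj₂ reflectionRepresentation)

  φ-gen : ∀ i → φ (gen i) ≗↔ reflection↔ i
  φ-gen = proj₂ (proj₂ reflectionRepresentation)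

  φ-e : φ e ≗↔ ↔-id _
  φ-e = GroupProperties.identityʳ-unique (symmetricGroup (W × Bool)) (φ e) (φ e)
          (λ p → trans (sym (φ-hom e e p)) (cong (λ w → Inverse.to (φ w) p) (identityˡ e)))

  φ-prod : ∀ ws p → Inverse.to (φ (prod ws)) p ≡ act ws p
  φ-prod []       p = φ-e p
  φ-prod (a ∷ ws) p = trans (φ-hom (gen a) (prod ws) p) (trans (φ-gen a _) (cong (reflect a) (φ-prod ws p)))

  reflectionParity-invariant : ∀ xs ys → prod xs ≡ prod ys → ∀ t → reflectionParity xs t ≡ reflectionParity ys t
  reflectionParity-invariant xs ys xs≡ys t = cong proj₂ (begin
    (prod xs · t · prod xs ⁻¹ , reflectionParity xs t)  ≡⟨ act-prod xs t false ⟨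
    act xs (t , false)                                  ≡⟨ φ-prod xs _ ⟨
    Inverse.to (φ (prod xs)) (t , false)                ≡⟨ cong (λ w → Inverse.to (φ w) (t , false)) xs≡ys ⟩
    Inverse.to (φ (prod ys)) (t , false)                ≡⟨ φ-prod ys _ ⟩
    act ys (t , false)                                  ≡⟨ act-prod ys t false ⟩
    (prod ys · t · prod ys ⁻¹ , reflectionParity ys t)  ∎)
    where open ≡-Reasoning

  record Deletion (zs : Word) (t : W) : Set where
    constructor deletion
    field
      before  : Word
      deleted : Fin n
      after   : Word
      split   : zs ≡ before ++ deleted ∷ after
      prod-·  : prod zs · t ≡ prod (before ++ after)

    remaining : Word
    remaining = before ++ after

  open Deletion using (remaining)

  reflectionParity⇒deletion : ∀ zs {t} → reflectionParity zs t ≡ true → Deletion zs t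
  reflectionParity⇒deletion (a ∷ ws) {t} parity with reflectionParity ws t in parity-ws
  ... | true with deletion xs b ys split prod-· ← reflectionParity⇒deletion ws parity-ws =
    deletion (a ∷ xs) b ys (cong (a ∷_) split) (trans (assoc _ _ _) (cong (gen a ·_) prod-·))
  ... | false = deletion [] a ws refl (begin
    (gen a · P) · t                  ≡⟨ cong ((gen a · P) ·_) (==⇒≡ parity) ⟩
    (gen a · P) · P ⁻¹ · gen a · P
      ≡⟨ solve 3 (λ x y z → (x ⊕ y) ⊕ z ⊕ x ⊕ y ⊜ x ⊕ (y ⊕ z) ⊕ x ⊕ y) refl (gen a) P (P ⁻¹) ⟩
    gen a · (P · P ⁻¹) · gen a · P   ≡⟨ cong (λ u → gen a · u · gen a · P) (inverseʳ P) ⟩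
    gen a · e · gen a · P            ≡⟨ cong (gen a ·_) (identityˡ _) ⟩
    gen a · gen a · P                ≡⟨ gen-gen-· a P ⟩
    P                                ∎)
    where
    open ≡-Reasoning
    P : W
    P = prod ws

  deletion-length : ∀ {zs t} (d : Deletion zs t) → length zs ≡ suc (length (remaining d))
  deletion-length (deletion xs b ys refl _) = length-++-sucʳ xs b ys

  deletion-shortens : ∀ {zs t} → Deletion zs t → ℓ (prod zs · t) < length zs
  deletion-shortens d@(deletion _ _ _ _ prod-·) =
    subst₂ _<_ (cong ℓ (sym prod-·)) (sym (deletion-length d)) (s≤s (ℓ-prod (remaining d)))

  All-deletion : ∀ {P : Fin n → Set} {zs t} → All P zs → (d : Deletion zs t) → All P (remaining d)
  All-deletion Pzs (deletion xs _ _ refl _) with Pxs , _ ∷ Pys ← AllP.++⁻ xs Pzs = AllP.++⁺ Pxs Pys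

  reflectionParity-∷ʳ : ∀ xs s t →
    reflectionParity (xs ∷ʳ s) t ≡ (t == gen s) xor reflectionParity xs (gen s · t · gen s)
  reflectionParity-∷ʳ []       s t = begin
    false xor (t == e ⁻¹ · gen s · e)  ≡⟨ cong (λ u → t == u · gen s · e) ε⁻¹≈ε ⟩
    (t == e · gen s · e)               ≡⟨ cong (t ==_) (trans (identityˡ _) (identityʳ _)) ⟩
    (t == gen s)                       ≡⟨ xor-identityʳ _ ⟨
    (t == gen s) xor false             ∎
    where open ≡-Reasoning
  reflectionParity-∷ʳ (a ∷ xs) s t = begin
    reflectionParity (xs ∷ʳ s) t xor (t == prod (xs ∷ʳ s) ⁻¹ · gen a · prod (xs ∷ʳ s))
      ≡⟨ cong₂ (λ u v → u xor (t == v ⁻¹ · gen a · v)) (reflectionParity-∷ʳ xs s t) (prod-∷ʳ xs s) ⟩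
    ((t == gen s) xor reflectionParity xs t′) xor (t == (X · gen s) ⁻¹ · gen a · X · gen s)
      ≡⟨ cong (((t == gen s) xor reflectionParity xs t′) xor_) conjugated ⟩
    ((t == gen s) xor reflectionParity xs t′) xor (t′ == X ⁻¹ · gen a · X)
      ≡⟨ xor-assoc (t == gen s) _ _ ⟩
    (t == gen s) xor (reflectionParity xs t′ xor (t′ == X ⁻¹ · gen a · X))  ∎
    where
    open ≡-Reasoning
    X t′ : W
    X  = prod xs
    t′ = gen s · t · gen s
    conjugated : (t == (X · gen s) ⁻¹ · gen a · X · gen s) ≡ (t′ == X ⁻¹ · gen a · X)
    conjugated = begin
      (t == (X · gen s) ⁻¹ · gen a · X · gen s)
        ≡⟨ cong (λ u → t == u · gen a · X · gen s) (⁻¹-anti-homo-∙ X (gen s)) ⟩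
      (t == (gen s ⁻¹ · X ⁻¹) · gen a · X · gen s)
        ≡⟨ cong (λ u → t == (u · X ⁻¹) · gen a · X · gen s) (gen⁻¹ s) ⟩
      (t == (gen s · X ⁻¹) · gen a · X · gen s)
        ≡⟨ cong (t ==_) (solve 4 (λ x y z w → (x ⊕ y) ⊕ z ⊕ w ⊕ x ⊜ x ⊕ (y ⊕ z ⊕ w) ⊕ x) refl (gen s) (X ⁻¹) (gen a) X) ⟩
      (t == gen s · (X ⁻¹ · gen a · X) · gen s)
        ≡⟨ ==-conjugate-gen s t _ ⟨
      (t′ == X ⁻¹ · gen a · X)
        ∎

  reflectionParity-flip : ∀ xs ys s → prod xs ≡ prod ys · gen s →
    reflectionParity xs (gen s) ≡ not (reflectionParity ys (gen s))
  reflectionParity-flip xs ys s xs≡ys·s = begin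
    reflectionParity xs (gen s)
      ≡⟨ reflectionParity-invariant xs (ys ∷ʳ s) (trans xs≡ys·s (sym (prod-∷ʳ ys s))) _ ⟩
    reflectionParity (ys ∷ʳ s) (gen s)
      ≡⟨ reflectionParity-∷ʳ ys s (gen s) ⟩
    (gen s == gen s) xor reflectionParity ys (gen s · gen s · gen s)
      ≡⟨ cong₂ (λ b u → b xor reflectionParity ys u) (dec-true (gen s ≟ gen s) refl) (gen-gen-· s (gen s)) ⟩
    not (reflectionParity ys (gen s))
      ∎
    where open ≡-Reasoning

  reflectionParity-true⇒descent : ∀ xs s → reflectionParity xs (gen s) ≡ true → ℓ (prod xs · gen s) < ℓ (prod xs)
  reflectionParity-true⇒descent xs s parity =
    subst₂ (λ u k → ℓ (u · gen s) < k) (prod-reducedWord w) (length-reducedWord w)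
      (deletion-shortens (reflectionParity⇒deletion (reducedWord w) parity′))
    where
    w : W
    w = prod xs
    parity′ : reflectionParity (reducedWord w) (gen s) ≡ true
    parity′ = trans (reflectionParity-invariant (reducedWord w) xs (prod-reducedWord w) (gen s)) parity

  reflectionParity-false⇒ascent : ∀ xs s → reflectionParity xs (gen s) ≡ false → ℓ (prod xs) < ℓ (prod xs · gen s)
  reflectionParity-false⇒ascent xs s parity =
    subst₂ (λ u u′ → ℓ u < ℓ u′) prod-v·s (prod-reducedWord v)
      (reflectionParity-true⇒descent (reducedWord v) s parity′)
    where
    v : W
    v = prod xs · gen s
    prod-v·s : prod (reducedWord v) · gen s ≡ prod xs
    prod-v·s = trans (cong (_· gen s) (prod-reducedWord v)) (·-gen-gen s (prod xs))
    parity′ : reflectionParity (reducedWord v) (gen s) ≡ true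
    parity′ = begin
      reflectionParity (reducedWord v) (gen s)
        ≡⟨ not-involutive _ ⟨
      not (not (reflectionParity (reducedWord v) (gen s)))
        ≡⟨ cong not (reflectionParity-flip xs (reducedWord v) s (sym prod-v·s)) ⟨
      not (reflectionParity xs (gen s))
        ≡⟨ cong not parity ⟩
      true
        ∎
      where open ≡-Reasoning

  descent-dichotomy : ∀ w s → ℓ (w · gen s) < ℓ w ⊎ ℓ w < ℓ (w · gen s)
  descent-dichotomy w s with reflectionParity (reducedWord w) (gen s) in parity
  ... | true  = inj₁ (subst (λ u → ℓ (u · gen s) < ℓ u) (prod-reducedWord w)
                       (reflectionParity-true⇒descent (reducedWord w) s parity))
  ... | false = inj₂ (subst (λ u → ℓ u < ℓ (u · gen s)) (prod-reducedWord w)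
                       (reflectionParity-false⇒ascent (reducedWord w) s parity))

  exchange : ∀ zs s → ℓ (prod zs · gen s) < ℓ (prod zs) → Deletion zs (gen s)
  exchange zs s descent with reflectionParity zs (gen s) in parity
  ... | true  = reflectionParity⇒deletion zs parity
  ... | false = ⊥-elim (<-asym descent (reflectionParity-false⇒ascent zs s parity))

  -- Reduced words and minimal coset representatives

  Reduced : Word → Set
  Reduced ws = length ws ≡ ℓ (prod ws)

  ReducedWordIn : Subset n → W → Set
  ReducedWordIn J w = ∃ λ rs → All (_∈ J) rs × prod rs ≡ w × Reduced rs

  ascent-length : ∀ w a → ℓ w < ℓ (w · gen a) → ℓ (w · gen a) ≡ suc (ℓ w)
  ascent-length w a ascent = ≤-antisym (ℓ-·gen w a) ascent

  Reduced-[] : Reduced []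
  Reduced-[] = sym (n≤0⇒n≡0 (ℓ-prod []))

  Reduced-∷ʳ : ∀ xs a → Reduced xs → ℓ (prod xs) < ℓ (prod xs · gen a) → Reduced (xs ∷ʳ a)
  Reduced-∷ʳ xs a reduced ascent = begin
    length (xs ∷ʳ a)       ≡⟨ length-∷ʳ xs a ⟩
    suc (length xs)        ≡⟨ cong suc reduced ⟩
    suc (ℓ (prod xs))      ≡⟨ ascent-length (prod xs) a ascent ⟨
    ℓ (prod xs · gen a)    ≡⟨ cong ℓ (prod-∷ʳ xs a) ⟨
    ℓ (prod (xs ∷ʳ a))     ∎
    where open ≡-Reasoning

  Reduced-∷ʳ⁻ : ∀ xs a → Reduced (xs ∷ʳ a) → Reduced xs
  Reduced-∷ʳ⁻ xs a reduced = ≤-antisym (≤-pred (begin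
    suc (length xs)          ≡⟨ length-∷ʳ xs a ⟨
    length (xs ∷ʳ a)         ≡⟨ reduced ⟩
    ℓ (prod (xs ∷ʳ a))       ≡⟨ cong ℓ (prod-∷ʳ xs a) ⟩
    ℓ (prod xs · gen a)      ≤⟨ ℓ-·gen (prod xs) a ⟩
    suc (ℓ (prod xs))        ∎)) (ℓ-prod xs)
    where open ≤-Reasoning

  Reduced-deletion : ∀ {rs} a → Reduced rs → (d : Deletion rs (gen a)) → Reduced (remaining d)
  Reduced-deletion {rs} a reduced d@(deletion _ _ _ _ prod-·) = ≤-antisym (≤-pred (begin
    suc (length (remaining d))      ≡⟨ deletion-length d ⟨
    length rs                       ≡⟨ reduced ⟩
    ℓ (prod rs)                     ≤⟨ ℓ≤ℓ-·gen (prod rs) a ⟩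
    suc (ℓ (prod rs · gen a))       ≡⟨ cong (suc ∘ ℓ) prod-· ⟩
    suc (ℓ (prod (remaining d)))    ∎)) (ℓ-prod (remaining d))
    where open ≤-Reasoning

  ·gen-∷ʳ : ∀ rs xs a → prod rs ≡ prod xs → prod rs · gen a ≡ prod (xs ∷ʳ a)
  ·gen-∷ʳ rs xs a rs≡xs = trans (cong (_· gen a) rs≡xs) (sym (prod-∷ʳ xs a))

  reduce-view : ∀ {J ws} → Reverse ws → All (_∈ J) ws → ReducedWordIn J (prod ws)
  reduce-view []             _   = [] , [] , refl , Reduced-[]
  reduce-view (xs ∶ r ∶ʳ a) Jws with Jxs , Ja ← AllP.∷ʳ⁻ Jws with reduce-view r Jxs
  ... | rs , Jrs , rs≡xs , reduced with descent-dichotomy (prod rs) a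
  ...   | inj₂ ascent  = rs ∷ʳ a , AllP.∷ʳ⁺ Jrs Ja , trans (prod-∷ʳ rs a) (·gen-∷ʳ rs xs a rs≡xs) ,
                         Reduced-∷ʳ rs a reduced ascent
  ...   | inj₁ descent = remaining d , All-deletion Jrs d , trans (sym (Deletion.prod-· d)) (·gen-∷ʳ rs xs a rs≡xs) ,
                         Reduced-deletion a reduced d
    where
    d : Deletion rs (gen a)
    d = exchange rs a descent

  reduce : ∀ {J w} → InW J w → ReducedWordIn J w
  reduce (ws , Jws , refl) = reduce-view (reverseView ws) Jws

  Minimal : Subset n → W → Set
  Minimal J u = ∀ {v} → InW J v → ℓ u ≤ ℓ (u · v)

  deletion-++ : ∀ xs ys {t} → Deletion (xs ++ ys) t →
    (∃ λ xs′ → length xs ≡ suc (length xs′) × prod (xs ++ ys) · t ≡ prod xs′ · prod ys) ⊎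
    (∃ λ ys′ → length ys ≡ suc (length ys′) × prod (xs ++ ys) · t ≡ prod xs · prod ys′)
  deletion-++ xs ys (deletion as b bs split prod-·) with split-++-∷ xs ys as bs split
  ... | inj₁ (cs , refl , refl) =
    inj₁ (as ++ cs , length-++-sucʳ as b cs ,
          trans prod-· (trans (cong prod (sym (++-assoc as cs ys))) (prod-++ (as ++ cs) ys)))
  ... | inj₂ (cs , refl , refl) =
    inj₂ (cs ++ bs , length-++-sucʳ cs b bs ,
          trans prod-· (trans (cong prod (++-assoc xs cs bs)) (prod-++ xs (cs ++ bs))))

  -- Exchanging a into (reducedWord u) ++ xs deletes a letter either from xs, contradicting
  -- that xs ∷ʳ a is reduced, or from reducedWord u, leaving the shorter element u v a v⁻¹ of u W_J.
  module _ {J u} (minimal : Minimal J u) xs a (Jxsa : All (_∈ J) (xs ∷ʳ a)) (reduced : Reduced (xs ∷ʳ a)) where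

    private
      v : W
      v = prod xs
      Jxs : All (_∈ J) xs
      Jxs = proj₁ (AllP.∷ʳ⁻ Jxsa)
      Ja : a ∈ J
      Ja = proj₂ (AllP.∷ʳ⁻ Jxsa)
      prod-us-xs : prod (reducedWord u ++ xs) ≡ u · v
      prod-us-xs = trans (prod-++ (reducedWord u) xs) (cong (_· v) (prod-reducedWord u))

      deletion-in-coset-representative : ∀ us′ → length (reducedWord u) ≡ suc (length us′) →
                                        ¬ ((u · v) · gen a ≡ prod us′ · v)
      deletion-in-coset-representative us′ length-us eq = 1+n≰n (begin
        suc (ℓ (prod us′))          ≤⟨ s≤s (ℓ-prod us′) ⟩
        suc (length us′)            ≡⟨ trans (sym length-us) (length-reducedWord u) ⟩
        ℓ u                         ≤⟨ minimal (InW-· (InW-· v∈W (InW-gen Ja)) (InW-⁻¹ v∈W)) ⟩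
        ℓ (u · (v · gen a) · v ⁻¹)  ≡⟨ cong ℓ u·vav⁻¹≡us′ ⟩
        ℓ (prod us′)                ∎)
        where
        open ≤-Reasoning
        v∈W : InW J v
        v∈W = xs , Jxs , refl
        u·vav⁻¹≡us′ : u · (v · gen a) · v ⁻¹ ≡ prod us′
        u·vav⁻¹≡us′ = trans (solve 4 (λ x y z w → x ⊕ (y ⊕ z) ⊕ w ⊜ ((x ⊕ y) ⊕ z) ⊕ w) refl u v (gen a) (v ⁻¹))
                            (trans (cong (_· v ⁻¹) eq) (//-rightDividesʳ v (prod us′)))

      deletion-in-reduced-word : ∀ xs′ → length xs ≡ suc (length xs′) → ¬ ((u · v) · gen a ≡ u · prod xs′)
      deletion-in-reduced-word xs′ length-xs eq = 1+n≰n (begin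
        suc (length xs)         ≡⟨ length-∷ʳ xs a ⟨
        length (xs ∷ʳ a)        ≡⟨ reduced ⟩
        ℓ (prod (xs ∷ʳ a))      ≡⟨ cong ℓ (trans (prod-∷ʳ xs a) v·a≡xs′) ⟩
        ℓ (prod xs′)            ≤⟨ ℓ-prod xs′ ⟩
        length xs′              <⟨ ≤-refl ⟩
        suc (length xs′)        ≡⟨ length-xs ⟨
        length xs               ∎)
        where
        open ≤-Reasoning
        v·a≡xs′ : v · gen a ≡ prod xs′
        v·a≡xs′ = ∙-cancelˡ u _ _ (trans (sym (assoc _ _ _)) eq)

    minimal-no-descent : ¬ (ℓ ((u · prod xs) · gen a) < ℓ (u · prod xs))
    minimal-no-descent descent with deletion-++ (reducedWord u) xs (exchange (reducedWord u ++ xs) a descent′)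
      where
      descent′ : ℓ (prod (reducedWord u ++ xs) · gen a) < ℓ (prod (reducedWord u ++ xs))
      descent′ = subst (λ w → ℓ (w · gen a) < ℓ w) (sym prod-us-xs) descent
    ... | inj₁ (us′ , length-us , eq) =
      deletion-in-coset-representative us′ length-us (trans (cong (_· gen a) (sym prod-us-xs)) eq)
    ... | inj₂ (xs′ , length-xs , eq) =
      deletion-in-reduced-word xs′ length-xs
        (trans (cong (_· gen a) (sym prod-us-xs)) (trans eq (cong (_· prod xs′) (prod-reducedWord u))))

  minimal-additive-view : ∀ {J u rs} → Minimal J u → Reverse rs → All (_∈ J) rs → Reduced rs →
                          ℓ (u · prod rs) ≡ ℓ u + length rs
  minimal-additive-view {u = u} minimal [] _ _ = trans (cong ℓ (identityʳ u)) (sym (+-identityʳ _))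
  minimal-additive-view {u = u} minimal (xs ∶ r ∶ʳ a) Jrs reduced with descent-dichotomy (u · prod xs) a
  ... | inj₁ descent = ⊥-elim (minimal-no-descent minimal xs a Jrs reduced descent)
  ... | inj₂ ascent  = begin
    ℓ (u · prod (xs ∷ʳ a))     ≡⟨ cong ℓ (trans (cong (u ·_) (prod-∷ʳ xs a)) (sym (assoc _ _ _))) ⟩
    ℓ ((u · prod xs) · gen a)  ≡⟨ ascent-length _ a ascent ⟩
    suc (ℓ (u · prod xs))
      ≡⟨ cong suc (minimal-additive-view minimal r (proj₁ (AllP.∷ʳ⁻ Jrs)) (Reduced-∷ʳ⁻ xs a reduced)) ⟩
    suc (ℓ u + length xs)      ≡⟨ +-suc _ _ ⟨
    ℓ u + suc (length xs)      ≡⟨ cong (ℓ u +_) (length-∷ʳ xs a) ⟨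
    ℓ u + length (xs ∷ʳ a)     ∎
    where open ≡-Reasoning

  minimal-additive : ∀ {J u v} → Minimal J u → InW J v → ℓ (u · v) ≡ ℓ u + ℓ v
  minimal-additive {u = u} minimal Jv with reduce Jv
  ... | rs , Jrs , refl , reduced =
    trans (minimal-additive-view minimal (reverseView rs) Jrs reduced) (cong (ℓ u +_) reduced)

  minimal-<-cancel : ∀ {J u a b} → Minimal J u → InW J a → InW J b → ℓ (u · a) < ℓ (u · b) → ℓ a < ℓ b
  minimal-<-cancel {u = u} minimal Ja Jb lt =
    +-cancelˡ-< (ℓ u) _ _ (subst₂ _<_ (minimal-additive minimal Ja) (minimal-additive minimal Jb) lt)

  minimal-<-mono : ∀ {J u a b} → Minimal J u → InW J a → InW J b → ℓ a < ℓ b → ℓ (u · a) < ℓ (u · b)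
  minimal-<-mono {u = u} minimal Ja Jb lt =
    subst₂ _<_ (sym (minimal-additive minimal Ja)) (sym (minimal-additive minimal Jb)) (+-monoʳ-< (ℓ u) lt)

  minimal-·⁻¹-longest : ∀ {J u v ω} → Minimal J u → InW J v → IsLongest ω → ω ≡ u · v → ∀ y → ℓ y ≤ ℓ (u · v ⁻¹)
  minimal-·⁻¹-longest {u = u} {v} {ω} minimal Jv ω-longest ω≡u·v y = subst (ℓ y ≤_) ℓω≡ (IsLongest⇒ℓ≤ ω-longest y)
    where
    open ≡-Reasoning
    ℓω≡ : ℓ ω ≡ ℓ (u · v ⁻¹)
    ℓω≡ = begin
      ℓ ω                ≡⟨ cong ℓ ω≡u·v ⟩
      ℓ (u · v)          ≡⟨ minimal-additive minimal Jv ⟩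
      ℓ u + ℓ v          ≡⟨ cong (ℓ u +_) (ℓ-⁻¹ v) ⟨
      ℓ u + ℓ (v ⁻¹)     ≡⟨ minimal-additive minimal (InW-⁻¹ Jv) ⟨
      ℓ (u · v ⁻¹)       ∎

  minimal⇒RightAscents : ∀ {J u} → Minimal J u → RightAscents J u
  minimal⇒RightAscents {u = u} minimal i i∈J with descent-dichotomy u i
  ... | inj₁ descent = ⊥-elim (<⇒≱ descent (minimal (InW-gen i∈J)))
  ... | inj₂ ascent  = ascent

  minimal-unique : ∀ {J u u′} → Minimal J u → Minimal J u′ → InW J (u ⁻¹ · u′) → u ≡ u′
  minimal-unique {u = u} {u′} minimal minimal′ Jd = begin
    u                  ≡⟨ identityʳ u ⟨
    u · e              ≡⟨ cong (u ·_) d≡e ⟨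
    u · u ⁻¹ · u′      ≡⟨ \\-leftDividesˡ u u′ ⟩
    u′                 ∎
    where
    open ≡-Reasoning
    d : W
    d = u ⁻¹ · u′
    u′·d⁻¹≡u : u′ · d ⁻¹ ≡ u
    u′·d⁻¹≡u = trans (cong (u′ ·_) (trans (⁻¹-anti-homo-∙ (u ⁻¹) u′) (cong (u′ ⁻¹ ·_) (⁻¹-involutive u))))
                     (\\-leftDividesˡ u′ u)
    ℓu≡ : ℓ u ≡ (ℓ u + ℓ d) + ℓ d
    ℓu≡ = begin
      ℓ u                  ≡⟨ cong ℓ u′·d⁻¹≡u ⟨
      ℓ (u′ · d ⁻¹)        ≡⟨ minimal-additive minimal′ (InW-⁻¹ Jd) ⟩
      ℓ u′ + ℓ (d ⁻¹)      ≡⟨ cong₂ _+_ (cong ℓ (sym (\\-leftDividesˡ u u′))) (ℓ-⁻¹ d) ⟩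
      ℓ (u · d) + ℓ d      ≡⟨ cong (_+ ℓ d) (minimal-additive minimal Jd) ⟩
      (ℓ u + ℓ d) + ℓ d    ∎
    d≡e : d ≡ e
    d≡e = ℓ≡0⇒≡e (m+n≡0⇒m≡0 (ℓ d) (sym (+-cancelˡ-≡ (ℓ u) 0 (ℓ d + ℓ d)
            (trans (+-identityʳ (ℓ u)) (trans ℓu≡ (+-assoc (ℓ u) (ℓ d) (ℓ d)))))))

  ℓ-max : ℕ
  ℓ-max = ℓ (argmax ℓ e elems)

  ℓ≤ℓ-max : ∀ w → ℓ w ≤ ℓ-max
  ℓ≤ℓ-max w = All.lookup (f[xs]≤f[argmax] {f = ℓ} e elems) (complete w)

  module _ (J : Subset n) (x : W) where

    private
      AttainedOnCoset : ℕ → Set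
      AttainedOnCoset k = ∃ λ ws → length ws ≤ ℓ-max × (All (_∈ J) ws × ℓ (x · prod ws) ≡ k)

      attainedOnCoset? : ∀ k → Dec (AttainedOnCoset k)
      attainedOnCoset? k =
        any-of-length≤? _ (λ ws → All.all? (_∈? J) ws ×-dec (ℓ (x · prod ws) ≟ℕ k)) ℓ-max

    -- Every element of W_J has a reduced J-word, of length at most ℓ-max, so minimising
    -- over J-words of bounded length finds the minimum of the coset x W_J.
    coset-minimum : ∃ λ v → InW J v × Minimal J (x · v)
    coset-minimum with least attainedOnCoset? ([] , z≤n , [] , refl)
    ... | _ , (ws , _ , Jws , refl) , below = prod ws , (ws , Jws , refl) , minimal
      where
      minimal : Minimal J (x · prod ws)
      minimal {v} Jv with reduce (InW-· (ws , Jws , refl) Jv)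
      ... | rs , Jrs , rs≡ws·v , reduced =
        subst (ℓ (x · prod ws) ≤_) (cong ℓ (trans (cong (x ·_) rs≡ws·v) (sym (assoc _ _ _))))
          (below _ (rs , subst (_≤ ℓ-max) (sym reduced) (ℓ≤ℓ-max (prod rs)) , Jrs , refl))

  RightAscents⇒≡minimal : ∀ {J u x} rs → Minimal J u → All (_∈ J) rs → Reduced rs →
                           x ≡ u · prod rs → RightAscents J x → x ≡ u
  RightAscents⇒≡minimal {J} {u} {x} rs minimal Jrs reduced x≡ ascents with reverseView rs
  ... | []           = trans x≡ (identityʳ u)
  ... | xs ∶ r ∶ʳ a = ⊥-elim (<-asym (ascents a (proj₂ (AllP.∷ʳ⁻ Jrs))) descent)
    where
    open ≤-Reasoning
    x·a≡ : x · gen a ≡ u · prod xs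
    x·a≡ = trans (cong (_· gen a) (trans x≡ (cong (u ·_) (prod-∷ʳ xs a))))
                 (trans (assoc _ _ _) (cong (u ·_) (·-gen-gen a (prod xs))))
    descent : ℓ (x · gen a) < ℓ x
    descent = begin-strict
      ℓ (x · gen a)               ≡⟨ cong ℓ x·a≡ ⟩
      ℓ (u · prod xs)             ≤⟨ ℓ-· u (prod xs) ⟩
      ℓ u + ℓ (prod xs)           ≤⟨ +-monoʳ-≤ (ℓ u) (ℓ-prod xs) ⟩
      ℓ u + length xs             <⟨ +-monoʳ-< (ℓ u) (subst (length xs <_) (sym (length-∷ʳ xs a)) ≤-refl) ⟩
      ℓ u + length (xs ∷ʳ a)      ≡⟨ minimal-additive-view minimal (xs ∶ r ∶ʳ a) Jrs reduced ⟨
      ℓ (u · prod (xs ∷ʳ a))      ≡⟨ cong ℓ x≡ ⟨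
      ℓ x                         ∎

  RightAscents⇒minimal : ∀ {J x} → RightAscents J x → Minimal J x
  RightAscents⇒minimal {J} {x} ascents with coset-minimum J x
  ... | v , Jv , minimal with reduce (InW-⁻¹ Jv)
  ... | rs , Jrs , rs≡v⁻¹ , reduced = subst (Minimal J) (sym x≡x·v) minimal
    where
    x≡x·v : x ≡ x · v
    x≡x·v = RightAscents⇒≡minimal rs minimal Jrs reduced
              (trans (sym (//-rightDividesʳ v x)) (cong ((x · v) ·_) (sym rs≡v⁻¹))) ascents

  -- Chains in P^(W,S)

  InX-antimono : ∀ {J J′ w} → J ⊆ J′ → InX J′ w → InX J w
  InX-antimono J⊆J′ x i i∈J = x i (J⊆J′ i∈J)

  ascend : ∀ J w → InXinv J w → (⊥ , w) ≤P (J , w)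
  ascend = ∪⁅⁆-induction (λ J → ∀ w → InXinv J w → (⊥ , w) ≤P (J , w)) (λ _ _ → ε)
    (λ J s s∉J ascend-J w w∈X → ascend-J w (InX-antimono (p⊆p∪q ⁅ s ⁆) w∈X) ◅◅ (up J s w s∉J w∈X ◅ ε))

  module LongestElement (ω : W) (ω-longest : ∀ y → ℓ y ≤ ℓ ω) where

    private
      v : Subset n → W
      v J = proj₁ (coset-minimum J ω)

      v∈W : ∀ J → InW J (v J)
      v∈W J = proj₁ (proj₂ (coset-minimum J ω))

    ξ : Subset n → W
    ξ J = ω · v J

    ξ-minimal : ∀ J → Minimal J (ξ J)
    ξ-minimal J = proj₂ (proj₂ (coset-minimum J ω))

    ξ-IsXi : ∀ J → IsXi J (ξ J)
    ξ-IsXi J = RightAscents⇒InX (minimal⇒RightAscents (ξ-minimal J)) , ω , v J ⁻¹ ,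
               ℓ≤⇒IsLongest ω-longest , InW-⁻¹ (v∈W J) , sym (//-rightDividesʳ (v J) ω)

    ξ⊥≡ω : ξ ⊥ ≡ ω
    ξ⊥≡ω = trans (cong (ω ·_) (InW-⊥ (v∈W ⊥))) (identityʳ ω)

    ξ-unique : ∀ {J u} → Minimal J u → InW J (ω ⁻¹ · u) → ξ J ≡ u
    ξ-unique {J} {u} minimal ω⁻¹u∈W =
      minimal-unique (ξ-minimal J) minimal (subst (InW J) v⁻¹ω⁻¹u≡ (InW-· (InW-⁻¹ (v∈W J)) ω⁻¹u∈W))
      where
      v⁻¹ω⁻¹u≡ : v J ⁻¹ · ω ⁻¹ · u ≡ ξ J ⁻¹ · u
      v⁻¹ω⁻¹u≡ = trans (sym (assoc _ _ _)) (cong (_· u) (sym (⁻¹-anti-homo-∙ ω (v J))))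

    module _ (J : Subset n) (s : Fin n) where

      private
        J′ : Subset n
        J′ = J ∪ ⁅ s ⁆

        J⊆J′ : J ⊆ J′
        J⊆J′ = p⊆p∪q ⁅ s ⁆

      α : W
      α = ξ J′ ⁻¹ · ξ J

      ξ≡ξ′·α : ξ J ≡ ξ J′ · α
      ξ≡ξ′·α = sym (\\-leftDividesˡ (ξ J′) (ξ J))

      α∈W : InW J′ α
      α∈W = subst (InW J′) v′⁻¹v≡α (InW-· (InW-⁻¹ (v∈W J′)) (InW-mono J⊆J′ (v∈W J)))
        where
        v′⁻¹v≡α : v J′ ⁻¹ · v J ≡ α
        v′⁻¹v≡α = begin
          v J′ ⁻¹ · v J                 ≡⟨ cong (v J′ ⁻¹ ·_) (\\-leftDividesʳ ω (v J)) ⟨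
          v J′ ⁻¹ · ω ⁻¹ · ω · v J      ≡⟨ assoc _ _ _ ⟨
          (v J′ ⁻¹ · ω ⁻¹) · ξ J        ≡⟨ cong (_· ξ J) (⁻¹-anti-homo-∙ ω (v J′)) ⟨
          ξ J′ ⁻¹ · ξ J                 ∎
          where open ≡-Reasoning

      α·gen∈W : ∀ {i} → i ∈ J → InW J′ (α · gen i)
      α·gen∈W i∈J = InW-· α∈W (InW-gen (J⊆J′ i∈J))

      α-ascents : RightAscents J α
      α-ascents i i∈J = minimal-<-cancel (ξ-minimal J′) α∈W (α·gen∈W i∈J)
        (subst₂ _<_ (cong ℓ ξ≡ξ′·α) (cong ℓ (trans (cong (_· gen i) ξ≡ξ′·α) (assoc _ _ _)))
          (minimal⇒RightAscents (ξ-minimal J) i i∈J))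

      α-IsAlpha : IsAlpha J s α
      α-IsAlpha = RightAscents⇒InX α-ascents , α∈W , ξ J , ξ J′ , ξ-IsXi J , ξ-IsXi J′ , ξ≡ξ′·α

      α⁻¹·-InXinv : ∀ c → InXinv J′ c → InXinv J (α ⁻¹ · c)
      α⁻¹·-InXinv c c∈X = RightAscents⇒InX ascents
        where
        c⁻¹-minimal : Minimal J′ (c ⁻¹)
        c⁻¹-minimal = RightAscents⇒minimal (InX⇒RightAscents c∈X)
        inverse≡ : (α ⁻¹ · c) ⁻¹ ≡ c ⁻¹ · α
        inverse≡ = trans (⁻¹-anti-homo-∙ (α ⁻¹) c) (cong (c ⁻¹ ·_) (⁻¹-involutive α))
        ascents : RightAscents J ((α ⁻¹ · c) ⁻¹)
        ascents i i∈J =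
          subst₂ _<_ (cong ℓ (sym inverse≡)) (cong ℓ (trans (sym (assoc _ _ _)) (cong (_· gen i) (sym inverse≡))))
            (minimal-<-mono c⁻¹-minimal α∈W (α·gen∈W i∈J) (α-ascents i i∈J))

    descend : ∀ J c → InXinv J c → (J , c) ≤P (⊥ , ξ ⊥ ⁻¹ · ξ J · c)
    descend = ∪⁅⁆-induction Descends base step
      where
      Descends : Subset n → Set
      Descends J = ∀ c → InXinv J c → (J , c) ≤P (⊥ , ξ ⊥ ⁻¹ · ξ J · c)

      base : Descends ⊥
      base c _ = subst (λ y → (⊥ , c) ≤P (⊥ , y)) (sym (\\-leftDividesʳ (ξ ⊥) c)) ε

      ξ·α⁻¹·c≡ : ∀ J s c → ξ J · α J s ⁻¹ · c ≡ ξ (J ∪ ⁅ s ⁆) · c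
      ξ·α⁻¹·c≡ J s c = begin
        ξ J · α J s ⁻¹ · c                    ≡⟨ cong (_· α J s ⁻¹ · c) (ξ≡ξ′·α J s) ⟩
        (ξ (J ∪ ⁅ s ⁆) · α J s) · α J s ⁻¹ · c  ≡⟨ assoc _ _ _ ⟩
        ξ (J ∪ ⁅ s ⁆) · α J s · α J s ⁻¹ · c    ≡⟨ cong (ξ (J ∪ ⁅ s ⁆) ·_) (\\-leftDividesˡ (α J s) c) ⟩
        ξ (J ∪ ⁅ s ⁆) · c                       ∎
        where open ≡-Reasoning

      step : ∀ J s → s ∉ J → Descends J → Descends (J ∪ ⁅ s ⁆)
      step J s s∉J descends c c∈X =
        down J s c (α J s) s∉J c∈X (α-IsAlpha J s) ◅
        subst (λ y → (J , α J s ⁻¹ · c) ≤P (⊥ , ξ ⊥ ⁻¹ · y)) (ξ·α⁻¹·c≡ J s c)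
          (descends (α J s ⁻¹ · c) (α⁻¹·-InXinv J s c c∈X))

    private
      a∈⊥∪⁅a⁆ : ∀ (a : Fin n) → a ∈ ⊥ ∪ ⁅ a ⁆
      a∈⊥∪⁅a⁆ a = x∈p∪q⁺ (inj₂ (x∈⁅x⁆ a))

      x∈⊥∪⁅y⁆⇒x≡y : ∀ {x y : Fin n} → x ∈ ⊥ ∪ ⁅ y ⁆ → x ≡ y
      x∈⊥∪⁅y⁆⇒x≡y {x} {y} x∈ = x∈⁅y⁆⇒x≡y y (subst (x ∈_) (∪-identityˡ ⁅ y ⁆) x∈)

    ω-descent : ∀ a → ℓ (ω · gen a) < ℓ ω
    ω-descent a with descent-dichotomy ω a
    ... | inj₁ descent = descent
    ... | inj₂ ascent  = ⊥-elim (<⇒≱ ascent (ω-longest _))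

    ω·gen-IsXi : ∀ a → IsXi (⊥ ∪ ⁅ a ⁆) (ω · gen a)
    ω·gen-IsXi a = RightAscents⇒InX ascents , ω , gen a , ℓ≤⇒IsLongest ω-longest , InW-gen (a∈⊥∪⁅a⁆ a) ,
                   sym (·-gen-gen a ω)
      where
      ascents : RightAscents (⊥ ∪ ⁅ a ⁆) (ω · gen a)
      ascents i i∈ = subst (λ j → ℓ (ω · gen a) < ℓ ((ω · gen a) · gen j)) (sym (x∈⊥∪⁅y⁆⇒x≡y i∈))
                       (subst (λ u → ℓ (ω · gen a) < ℓ u) (sym (·-gen-gen a ω)) (ω-descent a))

    gen-IsAlpha : ∀ a → IsAlpha ⊥ a (gen a)
    gen-IsAlpha a = (λ i i∈⊥ → ⊥-elim (∉⊥ i∈⊥)) , InW-gen (a∈⊥∪⁅a⁆ a) , ω , ω · gen a ,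
                    subst (IsXi ⊥) ξ⊥≡ω (ξ-IsXi ⊥) , ω·gen-IsXi a , sym (·-gen-gen a ω)

    left-ascent-≤P : ∀ a y → ℓ y < ℓ (gen a · y) → (⊥ , y) ≤P (⊥ , gen a · y)
    left-ascent-≤P a y ascent = subst (λ u → (⊥ , y) ≤P (⊥ , u · y)) (gen⁻¹ a)
      (up ⊥ a y ∉⊥ y⁻¹-ascent ◅ down ⊥ a y (gen a) ∉⊥ y⁻¹-ascent (gen-IsAlpha a) ◅ ε)
      where
      y⁻¹-ascent : InXinv (⊥ ∪ ⁅ a ⁆) y
      y⁻¹-ascent = RightAscents⇒InX λ i i∈ →
        subst (λ j → ℓ (y ⁻¹) < ℓ (y ⁻¹ · gen j)) (sym (x∈⊥∪⁅y⁆⇒x≡y i∈))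
          (subst₂ _<_ (sym (ℓ-⁻¹ y)) (trans (sym (ℓ-⁻¹ (gen a · y)))
            (cong ℓ (trans (⁻¹-anti-homo-∙ (gen a) y) (cong (y ⁻¹ ·_) (gen⁻¹ a))))) ascent)

    ≤P-left-multiply : ∀ ws x → ℓ (prod ws · x) ≡ length ws + ℓ x → (⊥ , x) ≤P (⊥ , prod ws · x)
    ≤P-left-multiply []       x _  = subst (λ u → (⊥ , x) ≤P (⊥ , u)) (sym (identityˡ x)) ε
    ≤P-left-multiply (a ∷ ws) x ℓ≡ = subst (λ u → (⊥ , x) ≤P (⊥ , u)) (sym (assoc (gen a) (prod ws) x))
      (≤P-left-multiply ws x ℓy≡ ◅◅ left-ascent-≤P a y (≤-reflexive (trans (cong suc ℓy≡) (sym ℓay≡))))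
      where
      y : W
      y = prod ws · x
      ℓay≡ : ℓ (gen a · y) ≡ suc (length ws + ℓ x)
      ℓay≡ = trans (cong ℓ (sym (assoc _ _ _))) ℓ≡
      ℓy≡ : ℓ y ≡ length ws + ℓ x
      ℓy≡ = ≤-antisym (≤-trans (ℓ-· (prod ws) x) (+-monoˡ-≤ (ℓ x) (ℓ-prod ws)))
                      (≤-pred (subst (_≤ suc (ℓ y)) ℓay≡ (ℓ-gen· y a)))

    ≤B⇒≤P : ∀ {x x′} → x ≤B x′ → (⊥ , x) ≤P (⊥ , x′)
    ≤B⇒≤P {x} {x′} (_ , x′≡y·x , a , b , c , Lx′ , ((ws , length-ws , refl) , _) , Lx , a≡b+c) =
      subst (λ u → (⊥ , x) ≤P (⊥ , u)) (sym x′≡y·x) (≤P-left-multiply ws x ℓ≡)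
      where
      ℓ≡ : ℓ (prod ws · x) ≡ length ws + ℓ x
      ℓ≡ = begin
        ℓ (prod ws · x)      ≡⟨ cong ℓ x′≡y·x ⟨
        ℓ x′                 ≡⟨ Len⇒≡ℓ Lx′ ⟨
        a                    ≡⟨ a≡b+c ⟩
        b + c                ≡⟨ cong₂ _+_ (sym length-ws) (Len⇒≡ℓ Lx) ⟩
        length ws + ℓ x      ∎
        where open ≡-Reasoning

mainTheorem2 : (C : CoxeterSystem) → let open Coxeter C in
    (K : Subset n) (z w : W) → InXinv K z →
    (ωS ξK ωK : W) → IsLongest ωS → InX K ξK → InW K ωK → ωS ≡ ξK ∙ ωK →
    (ωK ∙ z) ≤B w →
    (J : Subset n) → InXinv J w → (K , z) ≤P (J , w)
mainTheorem2 C K z w z∈X ωS ξK ωK ωS-longest ξK∈X ωK∈W ωS≡ξK·ωK ωK·z≤w J w∈X =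
  subst (λ y → (K , z) ≤P (⊥ , y)) ξ⊥⁻¹·ξK·z≡ωK·z (descend K z z∈X) ◅◅ ≤B⇒≤P ωK·z≤w ◅◅ ascend J w w∈X
  where
  open CoxeterTheory C
  open GroupProperties group using (⁻¹-anti-homo-∙; ⁻¹-involutive; //-rightDividesˡ)
  open IsGroup isGroup using (assoc)

  ξK-minimal : Minimal K ξK
  ξK-minimal = RightAscents⇒minimal (InX⇒RightAscents ξK∈X)

  -- Longest like ωS = ξK ωK, and chosen so that ω⁻¹ ξK = ωK without knowing ωK⁻¹ = ωK.
  ω : W
  ω = ξK · ωK ⁻¹

  open LongestElement ω (minimal-·⁻¹-longest ξK-minimal ωK∈W ωS-longest ωS≡ξK·ωK)

  ω⁻¹·ξK≡ωK : ω ⁻¹ · ξK ≡ ωK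
  ω⁻¹·ξK≡ωK = trans (cong (_· ξK) (trans (⁻¹-anti-homo-∙ ξK (ωK ⁻¹)) (cong (_· ξK ⁻¹) (⁻¹-involutive ωK))))
                    (//-rightDividesˡ ξK ωK)

  ξ-K≡ξK : ξ K ≡ ξK
  ξ-K≡ξK = ξ-unique ξK-minimal (subst (InW K) (sym ω⁻¹·ξK≡ωK) ωK∈W)

  ξ⊥⁻¹·ξK·z≡ωK·z : ξ ⊥ ⁻¹ · ξ K · z ≡ ωK · z
  ξ⊥⁻¹·ξK·z≡ωK·z = begin
    ξ ⊥ ⁻¹ · ξ K · z   ≡⟨ cong₂ (λ a b → a ⁻¹ · b · z) ξ⊥≡ω ξ-K≡ξK ⟩
    ω ⁻¹ · ξK · z      ≡⟨ assoc _ _ _ ⟨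
    (ω ⁻¹ · ξK) · z    ≡⟨ cong (_· z) ω⁻¹·ξK≡ωK ⟩
    ωK · z             ∎
    where open ≡-Reasoning
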